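{- In a dagger category $(\mathbb{X},\dagger)$, a map $f: A \to B$ has a Moore-Penrose polar decomposition if and only if $f$ is Moore-Penrose invertible and $f^\dagger f$ has a Moore-Penrose square root.
   Context: Composition is in diagrammatic order. A dagger category is a category with an identity-on-objects contravariant involutive functor $\dagger$. A partial isometry is $q$ with $qq^\dagger q = q$; a map $p: A\to A$ is positive if $p = gg^\dagger$ for some $g: A \to X$. A Moore-Penrose inverse of $f: A\to B$ is $f^\circ: B\to A$ with $ff^\circ f = f$, $f^\circ f f^\circ = f^\circ$, $(ff^\circ)^\dagger = ff^\circ$, $(f^\circ f)^\dagger = f^\circ f$; $f$ is Moore-Penrose invertible if one exists. A Moore-Penrose polar decomposition of $f: A\to B$ is a pair $(u: A\to B, h: B\to B)$ where $u$ is a partial isometry, $h$ is a positive map, $f = uh$, $h$ is Moore-Penrose invertible, and $u^\dagger u = hh^\circ$. A Moore-Penrose invertible positive map $p: A\to A$ has a Moore-Penrose square root if there is a Moore-Penrose invertible positive map $\sqrt{p}: A\to A$ with $\sqrt{p}\sqrt{p} = p$. -}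

module Defs where

open import Level using (Level; _⊔_; suc)
open import Data.Product using (Σ; _×_; _,_; ∃)
open import Relation.Binary using (Rel; IsEquivalence)

-- A category with hom-setoids; composition in DIAGRAMMATIC order:
-- for f : A ⇒ B and g : B ⇒ C, "first f then g" is written  f ▸ g : A ⇒ C.
record Category (o ℓ e : Level) : Set (suc (o ⊔ ℓ ⊔ e)) where
  infixr 9 _▸_
  infix  4 _≈_
  field
    Obj   : Set o
    _⇒_   : Obj → Obj → Set ℓ
    _≈_   : ∀ {A B} → Rel (A ⇒ B) e
    id    : ∀ {A} → A ⇒ A
    _▸_   : ∀ {A B C} → A ⇒ B → B ⇒ C → A ⇒ C
    ≈-equiv : ∀ {A B} → IsEquivalence (_≈_ {A} {B})
    ▸-resp-≈ : ∀ {A B C} {f f′ : A ⇒ B} {g g′ : B ⇒ C} →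
               f ≈ f′ → g ≈ g′ → f ▸ g ≈ f′ ▸ g′
    identityˡ : ∀ {A B} {f : A ⇒ B} → id ▸ f ≈ f
    identityʳ : ∀ {A B} {f : A ⇒ B} → f ▸ id ≈ f
    assoc : ∀ {A B C D} {f : A ⇒ B} {g : B ⇒ C} {h : C ⇒ D} →
            (f ▸ g) ▸ h ≈ f ▸ (g ▸ h)

record DaggerCategory (o ℓ e : Level) : Set (suc (o ⊔ ℓ ⊔ e)) where
  field
    category : Category o ℓ e
  open Category category public
  field
    _†       : ∀ {A B} → A ⇒ B → B ⇒ A
    †-resp-≈ : ∀ {A B} {f g : A ⇒ B} → f ≈ g → f † ≈ g †
    †-id     : ∀ {A} → (id {A}) † ≈ id
    †-▸      : ∀ {A B C} {f : A ⇒ B} {g : B ⇒ C} → (f ▸ g) † ≈ g † ▸ f †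
    †-invol  : ∀ {A B} {f : A ⇒ B} → (f †) † ≈ f

module DaggerNotions {o ℓ e} (𝕏 : DaggerCategory o ℓ e) where
  open DaggerCategory 𝕏

  IsPartialIsometry : ∀ {A B} → A ⇒ B → Set e
  IsPartialIsometry q = q ▸ q † ▸ q ≈ q

  IsPositive : ∀ {A} → A ⇒ A → Set (o ⊔ ℓ ⊔ e)
  IsPositive {A} p = Σ Obj λ X → Σ (A ⇒ X) λ g → p ≈ g ▸ g †

  IsMPInverse : ∀ {A B} → A ⇒ B → B ⇒ A → Set e
  IsMPInverse f f° =
    (f ▸ f° ▸ f ≈ f) × (f° ▸ f ▸ f° ≈ f°) ×
    ((f ▸ f°) † ≈ f ▸ f°) × ((f° ▸ f) † ≈ f° ▸ f)

  MPInvertible : ∀ {A B} → A ⇒ B → Set (ℓ ⊔ e)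
  MPInvertible {A} {B} f = Σ (B ⇒ A) λ f° → IsMPInverse f f°

  IsMPPolarDecomposition : ∀ {A B} → A ⇒ B → A ⇒ B → B ⇒ B → Set (o ⊔ ℓ ⊔ e)
  IsMPPolarDecomposition {A} {B} f u h =
    IsPartialIsometry u × IsPositive h × (f ≈ u ▸ h) ×
    Σ (B ⇒ B) λ h° → IsMPInverse h h° × (u † ▸ u ≈ h ▸ h°)

  HasMPPolarDecomposition : ∀ {A B} → A ⇒ B → Set (o ⊔ ℓ ⊔ e)
  HasMPPolarDecomposition {A} {B} f =
    Σ (A ⇒ B) λ u → Σ (B ⇒ B) λ h → IsMPPolarDecomposition f u h

  HasMPSquareRoot : ∀ {A} → A ⇒ A → Set (o ⊔ ℓ ⊔ e)
  HasMPSquareRoot {A} p =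
    Σ (A ⇒ A) λ s → MPInvertible s × IsPositive s × (s ▸ s ≈ p)

{-# OPTIONS --safe #-}
module Submission where

open import Defs
open import Data.Product using (_×_; _,_; proj₁; proj₂)
open import Function.Bundles using (_⇔_; mk⇔)
open import Relation.Binary using (Setoid)

-- If f = u h is an MP polar decomposition, then h° u† is an MP inverse of f and
-- f† f = h u† u h = h h h° h = h h.  Conversely, given an MP inverse of f and an
-- MP square root s of f† f, the pair (f s°, s) is a polar decomposition: the
-- identity s s = f† f gives (f s°)† (f s°) = s s°, and f = f s° s because f
-- factors as f°† f† f through f† f, which s° s fixes.
module MPPolarDecomposition {o ℓ e} (𝕏 : DaggerCategory o ℓ e) where
  open DaggerCategory 𝕏
  open DaggerNotions 𝕏

  private
    variable
      V W X Y Z : Obj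

  hom-setoid : Obj → Obj → Setoid ℓ e
  hom-setoid X Y = record { Carrier = X ⇒ Y ; _≈_ = _≈_ ; isEquivalence = ≈-equiv }

  module _ {X Y : Obj} where
    open Setoid (hom-setoid X Y) public using (refl; sym; trans)
    open import Relation.Binary.Reasoning.Setoid (hom-setoid X Y) public

  ▸-congˡ : {f f′ : X ⇒ Y} {g : Y ⇒ Z} → f ≈ f′ → f ▸ g ≈ f′ ▸ g
  ▸-congˡ p = ▸-resp-≈ p refl

  ▸-congʳ : {f : X ⇒ Y} {g g′ : Y ⇒ Z} → g ≈ g′ → f ▸ g ≈ f ▸ g′
  ▸-congʳ p = ▸-resp-≈ refl p

  extendʳ : {a : W ⇒ X} {b : X ⇒ Y} {c : W ⇒ Z} {d : Z ⇒ Y} {r : Y ⇒ V} →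
            a ▸ b ≈ c ▸ d → a ▸ b ▸ r ≈ c ▸ d ▸ r
  extendʳ eq = trans (sym assoc) (trans (▸-congˡ eq) assoc)

  IsSelfAdjoint : X ⇒ X → Set e
  IsSelfAdjoint p = p † ≈ p

  self-adjoint-resp-≈ : {p q : X ⇒ X} → p ≈ q → IsSelfAdjoint q → IsSelfAdjoint p
  self-adjoint-resp-≈ p≈q q†≈q = trans (†-resp-≈ p≈q) (trans q†≈q (sym p≈q))

  ▸†-self-adjoint : (g : X ⇒ Y) → IsSelfAdjoint (g ▸ g †)
  ▸†-self-adjoint g = trans †-▸ (▸-congˡ †-invol)

  positive⇒self-adjoint : {p : X ⇒ X} → IsPositive p → IsSelfAdjoint p
  positive⇒self-adjoint (_ , g , p≈gg†) = self-adjoint-resp-≈ p≈gg† (▸†-self-adjoint g)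

  f≈f°†▸f†▸f : {f : X ⇒ Y} {f° : Y ⇒ X} → IsMPInverse f f° → f ≈ f° † ▸ f † ▸ f
  f≈f°†▸f†▸f {f = f} {f°} (ff°f≈f , _ , ff°-sa , _) = begin
    f                    ≈⟨ sym ff°f≈f ⟩
    f ▸ f° ▸ f           ≈⟨ sym assoc ⟩
    (f ▸ f°) ▸ f         ≈⟨ ▸-congˡ (sym ff°-sa) ⟩
    (f ▸ f°) † ▸ f       ≈⟨ ▸-congˡ †-▸ ⟩
    (f° † ▸ f †) ▸ f     ≈⟨ assoc ⟩
    f° † ▸ f † ▸ f       ∎

  module Polar→MP {f u : X ⇒ Y} {h h° : Y ⇒ Y}
    (u-pi : IsPartialIsometry u) (f≈uh : f ≈ u ▸ h)
    (h-mp : IsMPInverse h h°) (u†u≈hh° : u † ▸ u ≈ h ▸ h°) where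

    private
      hh°h≈h = proj₁ h-mp
      h°hh°≈h° = proj₁ (proj₂ h-mp)
      h°h-sa = proj₂ (proj₂ (proj₂ h-mp))

    ff°≈uu† : f ▸ (h° ▸ u †) ≈ u ▸ u †
    ff°≈uu† = begin
      f ▸ (h° ▸ u †)         ≈⟨ trans (▸-congˡ f≈uh) assoc ⟩
      u ▸ h ▸ h° ▸ u †       ≈⟨ ▸-congʳ (extendʳ (sym u†u≈hh°)) ⟩
      u ▸ u † ▸ u ▸ u †      ≈⟨ trans (▸-congʳ (sym assoc)) (sym assoc) ⟩
      (u ▸ u † ▸ u) ▸ u †    ≈⟨ ▸-congˡ u-pi ⟩
      u ▸ u †                ∎

    f°f≈h°h : (h° ▸ u †) ▸ f ≈ h° ▸ h
    f°f≈h°h = begin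
      (h° ▸ u †) ▸ f         ≈⟨ trans (▸-congʳ f≈uh) assoc ⟩
      h° ▸ u † ▸ u ▸ h       ≈⟨ ▸-congʳ (extendʳ u†u≈hh°) ⟩
      h° ▸ h ▸ h° ▸ h        ≈⟨ trans (▸-congʳ (sym assoc)) (sym assoc) ⟩
      (h° ▸ h ▸ h°) ▸ h      ≈⟨ ▸-congˡ h°hh°≈h° ⟩
      h° ▸ h                 ∎

    mp-inverse : IsMPInverse f (h° ▸ u †)
    mp-inverse = ff°f≈f , f°ff°≈f° , ff°-sa , f°f-sa
      where
      ff°f≈f : f ▸ (h° ▸ u †) ▸ f ≈ f
      ff°f≈f = begin
        f ▸ (h° ▸ u †) ▸ f     ≈⟨ trans (sym assoc) (▸-congˡ ff°≈uu†) ⟩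
        (u ▸ u †) ▸ f          ≈⟨ ▸-congʳ f≈uh ⟩
        (u ▸ u †) ▸ u ▸ h      ≈⟨ trans (sym assoc) (▸-congˡ (trans assoc u-pi)) ⟩
        u ▸ h                  ≈⟨ sym f≈uh ⟩
        f                      ∎
      f°ff°≈f° : (h° ▸ u †) ▸ f ▸ (h° ▸ u †) ≈ h° ▸ u †
      f°ff°≈f° = begin
        (h° ▸ u †) ▸ f ▸ (h° ▸ u †)  ≈⟨ trans (sym assoc) (▸-congˡ f°f≈h°h) ⟩
        (h° ▸ h) ▸ h° ▸ u †          ≈⟨ trans (sym assoc) (▸-congˡ (trans assoc h°hh°≈h°)) ⟩
        h° ▸ u †                     ∎
      ff°-sa = self-adjoint-resp-≈ ff°≈uu† (▸†-self-adjoint u)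
      f°f-sa = self-adjoint-resp-≈ f°f≈h°h h°h-sa

    f†f≈hh : IsSelfAdjoint h → f † ▸ f ≈ h ▸ h
    f†f≈hh h-sa = begin
      f † ▸ f                ≈⟨ ▸-resp-≈ (†-resp-≈ f≈uh) f≈uh ⟩
      (u ▸ h) † ▸ u ▸ h      ≈⟨ ▸-congˡ (trans †-▸ (▸-congˡ h-sa)) ⟩
      (h ▸ u †) ▸ u ▸ h      ≈⟨ trans assoc (▸-congʳ (extendʳ u†u≈hh°)) ⟩
      h ▸ h ▸ h° ▸ h         ≈⟨ ▸-congʳ hh°h≈h ⟩
      h ▸ h                  ∎

  polar⇒MPInvertible×sqrt : {f : X ⇒ Y} →
    HasMPPolarDecomposition f → MPInvertible f × HasMPSquareRoot (f † ▸ f)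
  polar⇒MPInvertible×sqrt (u , h , u-pi , h-pos , f≈uh , h° , h-mp , u†u≈hh°) =
    (h° ▸ u † , mp-inverse) ,
    (h , (h° , h-mp) , h-pos , sym (f†f≈hh (positive⇒self-adjoint h-pos)))
    where open Polar→MP u-pi f≈uh h-mp u†u≈hh°

  sqrt⇒polar : {f : X ⇒ Y} {f° : Y ⇒ X} {s s° : Y ⇒ Y} →
    IsMPInverse f f° → IsPositive s → IsMPInverse s s° → s ▸ s ≈ f † ▸ f →
    IsMPPolarDecomposition f (f ▸ s°) s
  sqrt⇒polar {f = f} {f°} {s} {s°} f-mp s-pos s-mp@(ss°s≈s , s°ss°≈s° , ss°-sa , _) ss≈f†f =
    u-pi , s-pos , f≈us , s° , s-mp , u†u≈ss°
    where
    s°†s≈ss° : s° † ▸ s ≈ s ▸ s°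
    s°†s≈ss° = trans (▸-congʳ (sym (positive⇒self-adjoint s-pos))) (trans (sym †-▸) ss°-sa)

    u†u≈ss° : (f ▸ s°) † ▸ (f ▸ s°) ≈ s ▸ s°
    u†u≈ss° = begin
      (f ▸ s°) † ▸ (f ▸ s°)    ≈⟨ trans (▸-congˡ †-▸) assoc ⟩
      s° † ▸ f † ▸ f ▸ s°      ≈⟨ ▸-congʳ (extendʳ (sym ss≈f†f)) ⟩
      s° † ▸ s ▸ s ▸ s°        ≈⟨ extendʳ s°†s≈ss° ⟩
      s ▸ s° ▸ s ▸ s°          ≈⟨ ▸-congʳ s°ss°≈s° ⟩
      s ▸ s°                   ∎

    u-pi : IsPartialIsometry (f ▸ s°)
    u-pi = trans (▸-congʳ u†u≈ss°) (trans assoc (▸-congʳ s°ss°≈s°))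

    f†fs°s≈f†f : (f † ▸ f) ▸ s° ▸ s ≈ f † ▸ f
    f†fs°s≈f†f = begin
      (f † ▸ f) ▸ s° ▸ s       ≈⟨ ▸-congˡ (sym ss≈f†f) ⟩
      (s ▸ s) ▸ s° ▸ s         ≈⟨ trans assoc (▸-congʳ ss°s≈s) ⟩
      s ▸ s                    ≈⟨ ss≈f†f ⟩
      f † ▸ f                  ∎

    f≈us : f ≈ (f ▸ s°) ▸ s
    f≈us = sym (begin
      (f ▸ s°) ▸ s                 ≈⟨ trans assoc (▸-congˡ (f≈f°†▸f†▸f f-mp)) ⟩
      (f° † ▸ f † ▸ f) ▸ s° ▸ s    ≈⟨ trans assoc (▸-congʳ f†fs°s≈f†f) ⟩
      f° † ▸ f † ▸ f               ≈⟨ sym (f≈f°†▸f†▸f f-mp) ⟩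
      f                            ∎)

  MPInvertible×sqrt⇒polar : {f : X ⇒ Y} →
    MPInvertible f × HasMPSquareRoot (f † ▸ f) → HasMPPolarDecomposition f
  MPInvertible×sqrt⇒polar ((_ , f-mp) , s , (s° , s-mp) , s-pos , ss≈f†f) =
    _ , s , sqrt⇒polar f-mp s-pos s-mp ss≈f†f

open DaggerCategory using (Obj; _⇒_; _▸_; _†)
open DaggerNotions using (HasMPPolarDecomposition; MPInvertible; HasMPSquareRoot)

mainTheorem4 : ∀ {o ℓ e} (𝕏 : DaggerCategory o ℓ e) {A B : Obj 𝕏} (f : _⇒_ 𝕏 A B) →
    HasMPPolarDecomposition 𝕏 f ⇔ (MPInvertible 𝕏 f × HasMPSquareRoot 𝕏 (_▸_ 𝕏 (_† 𝕏 f) f))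
mainTheorem4 𝕏 f = mk⇔ polar⇒MPInvertible×sqrt MPInvertible×sqrt⇒polar
  where open MPPolarDecomposition 𝕏
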